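{- Let $m$ and $k$ be positive integers, let $G$ be a graph and let $S\subseteq V(G)$. (1) If $G$ is $k$-edge-connected, $k\ge 2m$, and $S\neq\emptyset$, then $$\Omega_m(G\setminus S)\le \sum_{v\in S}\frac{m (d_G(v)-2m)}{k}+\frac{2m}{k}\Omega_m(G[S]).$$ (2) If $G$ is $k$-tree-connected and $k\ge m$, then $$\Omega_m(G\setminus S)\le \sum_{v\in S}\Big(\frac{m(d_G(v)-m)}{k}-m\Big)+m+\frac{m}{k}\Omega_m(G[S]).$$
   Context: Graphs are finite, loopless, and may have multiple edges. A graph is $m$-tree-connected if it contains $m$ pairwise edge-disjoint spanning trees (a one-vertex graph is $m$-tree-connected). The $m$-tree-connected components of a graph are its maximal induced $m$-tree-connected subgraphs; their vertex sets partition the vertex set. For a partition $P$ of $V(H)$, $e_H(P)$ is the number of edges with ends in different parts; $\Omega_m(H)=m|P|-e_H(P)$ for $P$ the partition into vertex sets of the $m$-tree-connected components, and $\Omega_m=0$ for the graph with no vertices. $G[S]$ is the induced subgraph and $G\setminus S$ is obtained by deleting $S$. -}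

module Defs where

open import Data.Nat using (ℕ; zero; suc; _+_; _*_; _≤_)
open import Data.Integer as ℤ using (ℤ; +_; _-_)
open import Data.Bool using (Bool; true; false; _∧_; not; if_then_else_; _∨_; _xor_)
open import Data.Fin using (Fin; _≟_)
open import Data.List using (List; []; _∷_; length; filter; lookup; allFin; foldr; map)
open import Data.Bool.ListAction using (any)
open import Data.List.Relation.Unary.All using (All)
open import Data.List.Membership.Propositional using (_∈_)
open import Data.Product using (Σ; _×_; _,_; proj₁; proj₂; ∃)
open import Data.Sum using (_⊎_)
open import Data.Maybe using (Maybe; just; nothing)
open import Relation.Nullary using (¬_; does)
open import Relation.Binary.PropositionalEquality using (_≡_; _≢_)

countB : {A : Set} → (A → Bool) → List A → ℕ
countB p [] = 0
countB p (x ∷ xs) = (if p x then 1 else 0) + countB p xs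

filterB : {A : Set} → (A → Bool) → List A → List A
filterB p [] = []
filterB p (x ∷ xs) = if p x then x ∷ filterB p xs else filterB p xs

VSet : ℕ → Set
VSet N = Fin N → Bool

_⊆_ : {N : ℕ} → VSet N → VSet N → Set
X ⊆ Y = ∀ v → X v ≡ true → Y v ≡ true

size : {N : ℕ} → VSet N → ℕ
size {N} X = countB X (allFin N)

Edge : ℕ → Set
Edge N = Fin N × Fin N

-- A finite multigraph whose vertex set is a subset V of Fin N and whose
-- edges form a list (parallel edges allowed).
record Graph (N : ℕ) : Set where
  constructor graph
  field
    V : VSet N
    E : List (Edge N)
open Graph public

WF : {N : ℕ} → Graph N → Set
WF G = All (λ e → (proj₁ e ≢ proj₂ e) × (V G (proj₁ e) ≡ true × V G (proj₂ e) ≡ true)) (E G)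

eqb : {N : ℕ} → Fin N → Fin N → Bool
eqb u v = does (u ≟ v)

_[_] : {N : ℕ} → Graph N → VSet N → Graph N
G [ S ] = graph (λ v → V G v ∧ S v) (filterB (λ e → S (proj₁ e) ∧ S (proj₂ e)) (E G))

_∖_ : {N : ℕ} → Graph N → VSet N → Graph N
G ∖ S = G [ (λ v → not (S v)) ]

deg : {N : ℕ} → Graph N → Fin N → ℕ
deg G v = countB (λ e → eqb (proj₁ e) v ∨ eqb (proj₂ e) v) (E G)

cutSize : {N : ℕ} → Graph N → VSet N → ℕ
cutSize G X = countB (λ e → X (proj₁ e) xor X (proj₂ e)) (E G)

EdgeConnected : {N : ℕ} → ℕ → Graph N → Set
EdgeConnected {N} k G =
  (X : VSet N) → X ⊆ V G →
  (Σ (Fin N) λ u → X u ≡ true) →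
  (Σ (Fin N) λ v → V G v ≡ true × X v ≡ false) →
  k ≤ cutSize G X

EdgeIx : {N : ℕ} → Graph N → Set
EdgeIx G = Fin (length (E G))

Adj : {N : ℕ} → Edge N → Fin N → Fin N → Set
Adj (a , b) u w = (a ≡ u × b ≡ w) ⊎ (a ≡ w × b ≡ u)

data Reach {N : ℕ} (G : Graph N) (T : EdgeIx G → Bool) : Fin N → Fin N → Set where
  here : ∀ {u} → Reach G T u u
  step : ∀ {u w v} (i : EdgeIx G) → T i ≡ true → Adj (lookup (E G) i) u w →
         Reach G T w v → Reach G T u v

countTrue : {n : ℕ} → (Fin n → Bool) → ℕ
countTrue {n} T = size T

IsSpanningTree : {N : ℕ} → (G : Graph N) → (EdgeIx G → Bool) → Set
IsSpanningTree G T =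
  (∀ u v → V G u ≡ true → V G v ≡ true → Reach G T u v) ×
  (countTrue T + 1 ≡ size (V G))

-- The trees
-- are given by labelling each edge with the tree (if any) containing it,
-- which makes them pairwise edge-disjoint.  (A one-vertex graph is
-- m-tree-connected: take m empty trees.)
TreeConnected : {N : ℕ} → ℕ → Graph N → Set
TreeConnected m G =
  Σ (EdgeIx G → Maybe (Fin m)) λ c →
     (j : Fin m) → IsSpanningTree G (λ i → isj (c i) j)
  where
  isj : {m : ℕ} → Maybe (Fin m) → Fin m → Bool
  isj nothing j = false
  isj (just i) j = does (i ≟ j)

IsComponent : {N : ℕ} → ℕ → Graph N → VSet N → Set
IsComponent {N} m H X =
  X ⊆ V H × (Σ (Fin N) λ u → X u ≡ true) × TreeConnected m (H [ X ]) ×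
  ((Y : VSet N) → Y ⊆ V H → X ⊆ Y → TreeConnected m (H [ Y ]) → Y ⊆ X)

IsComponentPartition : {N : ℕ} → ℕ → Graph N → List (VSet N) → Set
IsComponentPartition {N} m H Xs =
  All (IsComponent m H) Xs ×
  (∀ v → V H v ≡ true → countB (λ X → X v) Xs ≡ 1)

crossEdges : {N : ℕ} → Graph N → List (VSet N) → ℕ
crossEdges H Xs =
  countB (λ e → not (any (λ X → X (proj₁ e) ∧ X (proj₂ e)) Xs)) (E H)

-- IsOmega m H ω : ω = Ω_m(H) = m|P| - e_H(P), P the partition into the
-- m-tree-connected components (for the empty graph P = [] and ω = 0).
IsOmega : {N : ℕ} → ℕ → Graph N → ℤ → Set
IsOmega m H ω = Σ _ λ Xs → IsComponentPartition m H Xs ×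
  (ω ≡ + (m * length Xs) - + (crossEdges H Xs))

sumOver : {N : ℕ} → VSet N → (Fin N → ℤ) → ℤ
sumOver {N} S f = foldr (λ v acc → (if S v then f v else + 0) ℤ.+ acc) (+ 0) (allFin N)

-- Let P₁ and P₂ be the partitions of G ∖ S and of G[S] into m-tree-connected components,
-- write pᵢ = |Pᵢ| and Eᵢ = e(Pᵢ), so that Ω_m = m pᵢ − Eᵢ, and let eS = |E(G[S])| and
-- D = Σ_{v∈S} d_G(v) = 2 eS + e_G(S, V(G) ∖ S).
-- Counting tree edges, an m-tree-connected graph H has m |V(H)| ≤ m + |E(H)|; summed over the
-- components of G[S] this gives m |S| + E₂ ≤ m p₂ + eS.
-- (1) At least k edges leave each component of G ∖ S; such an edge either joins two components,
-- and is then counted twice, or ends in S.  Hence k p₁ ≤ 2 E₁ + D − 2 eS.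
-- (2) Each of the k edge-disjoint spanning trees has at least p₁ + |S| − 1 edges between the
-- parts of the partition of V(G) into the components of G ∖ S and the singletons of S, and each
-- such edge is crossing in G ∖ S or meets S.  Hence k (p₁ + |S|) ≤ k + E₁ + D − eS.
-- In both cases the claim is a nonnegative combination of these inequalities, using 2m ≤ k,
-- respectively m ≤ k.

module Submission where

open import Defs
open import Data.Bool using (Bool; true; false; _∧_; _∨_; not; if_then_else_; _xor_)
open import Data.Bool.Properties using (∧-identityʳ; ∧-zeroʳ; ∧-conicalˡ; ∧-conicalʳ; ∨-assoc)
open import Data.Bool.ListAction using (any)
open import Data.Empty using (⊥-elim)
open import Data.Fin using (Fin; zero; suc; _≟_; punchIn; punchOut)
open import Data.Fin.Properties using (punchOut-cong; punchOut-punchIn; punchInᵢ≢i)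
open import Data.Integer as ℤ using (ℤ; _-_; +≤+)
import Data.Integer.Properties as ℤP
open import Data.Integer.Tactic.RingSolver using (solve-∀)
open import Data.List using (List; []; _∷_; length; lookup; allFin; map; _++_; foldr)
open import Data.List.Properties using (length-++; length-map; map-tabulate; length-tabulate)
open import Data.List.Membership.Propositional using (_∈_)
open import Data.List.Membership.Propositional.Properties using (∈-allFin)
open import Data.List.Relation.Unary.Any using (here; there)
open import Data.List.Relation.Unary.All as All using (All; []; _∷_)
open import Data.List.Relation.Unary.All.Properties using (++⁺; map⁺)
open import Data.Maybe using (just; nothing)
open import Data.Nat using (ℕ; zero; suc; _+_; _*_; _≤_; z≤n; s≤s)
open import Data.Nat.Properties hiding (_≟_)
open import Data.Nat.Tactic.RingSolver using () renaming (solve-∀ to solve-∀ℕ)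
open import Algebra.Properties.CommutativeSemigroup +-commutativeSemigroup
  using () renaming (interchange to +-interchange)
open import Data.Product using (Σ; _×_; _,_; proj₁; proj₂)
open import Data.Sum using (inj₁; inj₂)
open import Function using (_∘_; id)
open import Relation.Binary.PropositionalEquality hiding ([_])
open import Relation.Nullary using (yes; no; contradiction)
open import Relation.Nullary.Decidable using (dec-true; dec-false)

private variable
  A B : Set
  N k m : ℕ

𝟙 : Bool → ℕ
𝟙 b = if b then 1 else 0

𝟙≤1 : ∀ b → 𝟙 b ≤ 1
𝟙≤1 true  = ≤-refl
𝟙≤1 false = z≤n

𝟙-∧≤ʳ : ∀ a b → 𝟙 (a ∧ b) ≤ 𝟙 b
𝟙-∧≤ʳ true  b = ≤-refl
𝟙-∧≤ʳ false b = z≤n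

𝟙-not+𝟙 : ∀ b → 𝟙 (not b) + 𝟙 b ≡ 1
𝟙-not+𝟙 true  = refl
𝟙-not+𝟙 false = refl

∧-intro : ∀ {a b} → a ≡ true → b ≡ true → (a ∧ b) ≡ true
∧-intro refl refl = refl

∑ : (A → ℕ) → List A → ℕ
∑ f []       = 0
∑ f (x ∷ xs) = f x + ∑ f xs

module _ {f g : A → ℕ} where

  ∑-congᴬ : ∀ {xs} → All (λ x → f x ≡ g x) xs → ∑ f xs ≡ ∑ g xs
  ∑-congᴬ []         = refl
  ∑-congᴬ (eq ∷ eqs) = cong₂ _+_ eq (∑-congᴬ eqs)

  ∑-monoᴬ : ∀ {xs} → All (λ x → f x ≤ g x) xs → ∑ f xs ≤ ∑ g xs
  ∑-monoᴬ []         = z≤n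
  ∑-monoᴬ (le ∷ les) = +-mono-≤ le (∑-monoᴬ les)

  ∑-cong : ∀ xs → (∀ x → f x ≡ g x) → ∑ f xs ≡ ∑ g xs
  ∑-cong xs eq = ∑-congᴬ (All.universal eq xs)

  ∑-mono : ∀ xs → (∀ x → f x ≤ g x) → ∑ f xs ≤ ∑ g xs
  ∑-mono xs le = ∑-monoᴬ (All.universal le xs)

  ∑-+ : ∀ xs → ∑ (λ x → f x + g x) xs ≡ ∑ f xs + ∑ g xs
  ∑-+ []       = refl
  ∑-+ (x ∷ xs) = trans (cong (f x + g x +_) (∑-+ xs)) (+-interchange (f x) (g x) (∑ f xs) (∑ g xs))

∑-mono₂ : ∀ {f g h k : A → ℕ} xs → (∀ x → f x + g x ≤ h x + k x) →
          ∑ f xs + ∑ g xs ≤ ∑ h xs + ∑ k xs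
∑-mono₂ xs le = subst₂ _≤_ (∑-+ xs) (∑-+ xs) (∑-mono xs le)

∑-*ˡ : ∀ c (f : A → ℕ) xs → ∑ (λ x → c * f x) xs ≡ c * ∑ f xs
∑-*ˡ c f []       = sym (*-zeroʳ c)
∑-*ˡ c f (x ∷ xs) = trans (cong (c * f x +_) (∑-*ˡ c f xs)) (sym (*-distribˡ-+ c (f x) (∑ f xs)))

∑-const : ∀ c (xs : List A) → ∑ (λ _ → c) xs ≡ c * length xs
∑-const c []       = sym (*-zeroʳ c)
∑-const c (x ∷ xs) = trans (cong (c +_) (∑-const c xs)) (sym (*-suc c (length xs)))

∑-1 : (xs : List A) → ∑ (λ _ → 1) xs ≡ length xs
∑-1 []       = refl
∑-1 (x ∷ xs) = cong suc (∑-1 xs)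

∑-comm : ∀ (f : A → B → ℕ) xs ys → ∑ (λ x → ∑ (f x) ys) xs ≡ ∑ (λ y → ∑ (λ x → f x y) xs) ys
∑-comm f []       ys = sym (∑-const 0 ys)
∑-comm f (x ∷ xs) ys = trans (cong (∑ (f x) ys +_) (∑-comm f xs ys)) (sym (∑-+ ys))

countB≡∑ : (p : A → Bool) (xs : List A) → countB p xs ≡ ∑ (𝟙 ∘ p) xs
countB≡∑ p []       = refl
countB≡∑ p (x ∷ xs) = cong (𝟙 (p x) +_) (countB≡∑ p xs)

∑-*𝟙 : ∀ c (p : A → Bool) xs → ∑ (λ x → c * 𝟙 (p x)) xs ≡ c * countB p xs
∑-*𝟙 c p xs = trans (∑-*ˡ c (𝟙 ∘ p) xs) (cong (c *_) (sym (countB≡∑ p xs)))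

countB-comm : ∀ (p : A → B → Bool) xs ys →
              ∑ (λ x → countB (p x) ys) xs ≡ ∑ (λ y → countB (λ x → p x y) xs) ys
countB-comm p xs ys = begin
  ∑ (λ x → countB (p x) ys) xs          ≡⟨ ∑-cong xs (λ x → countB≡∑ (p x) ys) ⟩
  ∑ (λ x → ∑ (λ y → 𝟙 (p x y)) ys) xs   ≡⟨ ∑-comm (λ x y → 𝟙 (p x y)) xs ys ⟩
  ∑ (λ y → ∑ (λ x → 𝟙 (p x y)) xs) ys   ≡⟨ ∑-cong ys (λ y → countB≡∑ (λ x → p x y) xs) ⟨
  ∑ (λ y → countB (λ x → p x y) xs) ys  ∎
  where open ≡-Reasoning

countB-cong : ∀ {p q : A → Bool} xs → (∀ x → p x ≡ q x) → countB p xs ≡ countB q xs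
countB-cong []       eq = refl
countB-cong (x ∷ xs) eq = cong₂ (λ b n → 𝟙 b + n) (eq x) (countB-cong xs eq)

countB-mono : ∀ {p q : A → Bool} xs → (∀ x → p x ≡ true → q x ≡ true) → countB p xs ≤ countB q xs
countB-mono []       p⇒q = z≤n
countB-mono {p = p} {q} (x ∷ xs) p⇒q with p x in px
... | true  rewrite p⇒q x px = s≤s (countB-mono xs p⇒q)
... | false = ≤-trans (countB-mono xs p⇒q) (m≤n+m _ (𝟙 (q x)))

countB-strict : ∀ {p q : A → Bool} xs → (∀ x → q x ≡ true → p x ≡ true) →
                ∀ {y} → y ∈ xs → p y ≡ true → q y ≡ false → suc (countB q xs) ≤ countB p xs
countB-strict (x ∷ xs) q⇒p (here refl) py qy rewrite py | qy = s≤s (countB-mono xs q⇒p)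
countB-strict {p = p} {q} (x ∷ xs) q⇒p (there y∈xs) py qy with q x in qx
... | true  rewrite q⇒p x qx = s≤s (countB-strict xs q⇒p y∈xs py qy)
... | false = ≤-trans (countB-strict xs q⇒p y∈xs py qy) (m≤n+m _ (𝟙 (p x)))

countB-∨ : ∀ {p q : A → Bool} xs → (∀ x → (p x ∧ q x) ≡ false) →
           countB (λ x → p x ∨ q x) xs ≡ countB p xs + countB q xs
countB-∨ []       disj = refl
countB-∨ {p = p} {q} (x ∷ xs) disj with p x | q x | disj x
... | true  | false | _ = cong suc (countB-∨ xs disj)
... | false | true  | _ = trans (cong suc (countB-∨ xs disj)) (sym (+-suc _ _))
... | false | false | _ = countB-∨ xs disj

countB-xor : ∀ (p q : A → Bool) xs →
  countB (λ x → p x xor q x) xs + 2 * countB (λ x → p x ∧ q x) xs ≡ countB p xs + countB q xs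
countB-xor p q []       = refl
countB-xor p q (x ∷ xs) with p x | q x
... | true  | true  = begin
  X + 2 * suc Y           ≡⟨ cong (X +_) (*-suc 2 Y) ⟩
  X + suc (suc (2 * Y))   ≡⟨ trans (+-suc X _) (cong suc (+-suc X _)) ⟩
  suc (suc (X + 2 * Y))   ≡⟨ cong (2 +_) (countB-xor p q xs) ⟩
  suc (suc (P + Q))       ≡⟨ cong suc (sym (+-suc P Q)) ⟩
  suc P + suc Q           ∎
  where
  open ≡-Reasoning
  X Y P Q : ℕ
  X = countB (λ x → p x xor q x) xs
  Y = countB (λ x → p x ∧ q x) xs
  P = countB p xs
  Q = countB q xs
... | true  | false = cong suc (countB-xor p q xs)
... | false | true  = trans (cong suc (countB-xor p q xs)) (sym (+-suc _ _))
... | false | false = countB-xor p q xs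

countB≡0 : {p : A → Bool} (xs : List A) → (∀ x → p x ≡ false) → countB p xs ≡ 0
countB≡0 []       none = refl
countB≡0 (x ∷ xs) none rewrite none x = countB≡0 xs none

countB-filterB : ∀ (p q : A → Bool) xs → countB p (filterB q xs) ≡ countB (λ x → q x ∧ p x) xs
countB-filterB p q []       = refl
countB-filterB p q (x ∷ xs) with q x
... | true  = cong (𝟙 (p x) +_) (countB-filterB p q xs)
... | false = countB-filterB p q xs

length-filterB : ∀ (q : A → Bool) xs → length (filterB q xs) ≡ countB q xs
length-filterB q []       = refl
length-filterB q (x ∷ xs) with q x
... | true  = cong suc (length-filterB q xs)
... | false = length-filterB q xs

filterB-sound : ∀ (q : A → Bool) xs → All (λ x → q x ≡ true) (filterB q xs)
filterB-sound q []       = []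
filterB-sound q (x ∷ xs) with q x in qx
... | true  = qx ∷ filterB-sound q xs
... | false = filterB-sound q xs

countB-map : ∀ (p : B → Bool) (f : A → B) xs → countB p (map f xs) ≡ countB (p ∘ f) xs
countB-map p f []       = refl
countB-map p f (x ∷ xs) = cong (𝟙 (p (f x)) +_) (countB-map p f xs)

countB-++ : ∀ (p : A → Bool) xs ys → countB p (xs ++ ys) ≡ countB p xs + countB p ys
countB-++ p []       ys = refl
countB-++ p (x ∷ xs) ys = trans (cong (𝟙 (p x) +_) (countB-++ p xs ys)) (sym (+-assoc (𝟙 (p x)) _ _))

any-++ : ∀ (p : A → Bool) xs ys → any p (xs ++ ys) ≡ any p xs ∨ any p ys
any-++ p []       ys = refl
any-++ p (x ∷ xs) ys = trans (cong (p x ∨_) (any-++ p xs ys)) (sym (∨-assoc (p x) _ _))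

any⇒lookup : ∀ (p : A → Bool) xs → any p xs ≡ true → Σ (Fin (length xs)) λ i → p (lookup xs i) ≡ true
any⇒lookup p (x ∷ xs) h with p x in px
... | true  = zero , px
... | false with any⇒lookup p xs h
... | i , pi = suc i , pi

lookup⇒1≤countB : ∀ (p : A → Bool) xs i → p (lookup xs i) ≡ true → 1 ≤ countB p xs
lookup⇒1≤countB p (x ∷ xs) zero    px rewrite px = s≤s z≤n
lookup⇒1≤countB p (x ∷ xs) (suc i) pi = ≤-trans (lookup⇒1≤countB p xs i pi) (m≤n+m _ (𝟙 (p x)))

any⇒1≤countB : ∀ (p : A → Bool) xs → any p xs ≡ true → 1 ≤ countB p xs
any⇒1≤countB p xs h = let i , pi = any⇒lookup p xs h in lookup⇒1≤countB p xs i pi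

¬any⇒countB≡0 : ∀ (p : A → Bool) xs → any p xs ≡ false → countB p xs ≡ 0
¬any⇒countB≡0 p []       _ = refl
¬any⇒countB≡0 p (x ∷ xs) h with p x
... | false = ¬any⇒countB≡0 p xs h

countB+𝟙¬any≤1 : ∀ (p : A → Bool) xs → countB p xs ≤ 1 → countB p xs + 𝟙 (not (any p xs)) ≤ 1
countB+𝟙¬any≤1 p xs ≤1 with any p xs in anyp
... | true  = subst (_≤ 1) (sym (+-identityʳ _)) ≤1
... | false rewrite ¬any⇒countB≡0 p xs anyp = ≤-refl

lookupᴬ : {P : A → Set} {xs : List A} → All P xs → ∀ i → P (lookup xs i)
lookupᴬ (px ∷ _)   zero    = px
lookupᴬ (_  ∷ pxs) (suc i) = lookupᴬ pxs i

length-allFin : ∀ n → length (allFin n) ≡ n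
length-allFin n = length-tabulate id

countB-allFin-suc : ∀ {n} (p : Fin (suc n) → Bool) →
                    countB p (allFin (suc n)) ≡ 𝟙 (p zero) + countB (p ∘ suc) (allFin n)
countB-allFin-suc {n} p =
  cong (𝟙 (p zero) +_) (trans (cong (countB p) (sym (map-tabulate id suc))) (countB-map p suc (allFin n)))

countB-lookup : ∀ (p : A → Bool) xs → countB (p ∘ lookup xs) (allFin (length xs)) ≡ countB p xs
countB-lookup p []       = refl
countB-lookup p (x ∷ xs) = trans (countB-allFin-suc (p ∘ lookup (x ∷ xs))) (cong (𝟙 (p x) +_) (countB-lookup p xs))

eqb-refl : ∀ {n} (a : Fin n) → eqb a a ≡ true
eqb-refl a = dec-true (a ≟ a) refl

eqb-false : ∀ {n} {a b : Fin n} → a ≢ b → eqb a b ≡ false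
eqb-false {a = a} {b} = dec-false (a ≟ b)

eqb-disjoint : ∀ {n} {a b : Fin n} → a ≢ b → ∀ v → (eqb a v ∧ eqb b v) ≡ false
eqb-disjoint {a = a} {b} a≢b v with a ≟ v | b ≟ v
... | yes refl | yes refl = contradiction refl a≢b
... | yes _    | no _     = refl
... | no _     | _        = refl

countB-eqb : ∀ {n} (p : Fin n → Bool) a → countB (λ v → p v ∧ eqb a v) (allFin n) ≡ 𝟙 (p a)
countB-eqb {suc n} p zero = begin
  countB (λ v → p v ∧ eqb zero v) (allFin (suc n))  ≡⟨ countB-allFin-suc (λ v → p v ∧ eqb zero v) ⟩
  𝟙 (p zero ∧ true) + countB (λ v → p (suc v) ∧ false) (allFin n)
    ≡⟨ cong₂ _+_ (cong 𝟙 (∧-identityʳ (p zero))) (countB≡0 (allFin n) (λ v → ∧-zeroʳ (p (suc v)))) ⟩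
  𝟙 (p zero) + 0                                    ≡⟨ +-identityʳ _ ⟩
  𝟙 (p zero)                                        ∎
  where open ≡-Reasoning
countB-eqb {suc n} p (suc a) =
  trans (countB-allFin-suc (λ v → p v ∧ eqb (suc a) v))
        (trans (cong₂ _+_ (cong 𝟙 (∧-zeroʳ (p zero))) refl) (countB-eqb (p ∘ suc) a))

countB-eqb-filterB : ∀ {n} (p : Fin n → Bool) a → countB (eqb a) (filterB p (allFin n)) ≡ 𝟙 (p a)
countB-eqb-filterB {n} p a = trans (countB-filterB (eqb a) p (allFin n)) (countB-eqb p a)

-- Connected spanning subgraphs cross every partition

inside : VSet N → Edge N → Bool
inside X e = X (proj₁ e) ∧ X (proj₂ e)

crossing : List (VSet N) → Edge N → Bool
crossing Xs e = not (any (λ X → inside X e) Xs)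

cover : List (VSet N) → Fin N → ℕ
cover Xs v = countB (λ X → X v) Xs

⦅_⦆ : Fin N → VSet N
⦅ t ⦆ v = eqb v t

ends : VSet N → Edge N → ℕ
ends S e = 𝟙 (S (proj₁ e)) + 𝟙 (S (proj₂ e))

Meets : Graph N → VSet N → Set
Meets {N} G X = Σ (Fin N) λ v → X v ≡ true × V G v ≡ true

Connected : (G : Graph N) → (EdgeIx G → Bool) → Set
Connected G T = ∀ u v → V G u ≡ true → V G v ≡ true → Reach G T u v

size-∧ : {X Y : VSet N} → X ⊆ Y → size (λ v → Y v ∧ X v) ≡ size X
size-∧ {N} {X} {Y} X⊆Y = countB-cong (allFin N) pointwise
  where
  pointwise : ∀ v → (Y v ∧ X v) ≡ X v
  pointwise v with X v in Xv
  ... | true  rewrite X⊆Y v Xv = refl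
  ... | false = ∧-zeroʳ (Y v)

crosses : {q : ℕ} → (Fin N → Fin q) → Edge N → Bool
crosses lab e = not (eqb (lab (proj₁ e)) (lab (proj₂ e)))

crosses-≡ : ∀ {q} {lab : Fin N → Fin q} {e} → lab (proj₁ e) ≡ lab (proj₂ e) → crosses lab e ≡ false
crosses-≡ {lab = lab} {e} eq = cong not (trans (cong (λ x → eqb x (lab (proj₂ e))) eq) (eqb-refl (lab (proj₂ e))))

crosses-∘ : ∀ {q r} (f : Fin q → Fin r) (lab : Fin N → Fin q) e →
            crosses (f ∘ lab) e ≡ true → crosses lab e ≡ true
crosses-∘ f lab e h with lab (proj₁ e) ≟ lab (proj₂ e)
... | yes eq = contradiction (trans (sym h) (crosses-≡ {lab = f ∘ lab} {e = e} (cong f eq))) λ ()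
... | no _   = refl

adjacent-crosses : ∀ {q} (lab : Fin N → Fin q) e {u w} → Adj e u w → lab u ≢ lab w → crosses lab e ≡ true
adjacent-crosses lab (a , b) (inj₁ (refl , refl)) ne = cong not (eqb-false ne)
adjacent-crosses lab (a , b) (inj₂ (refl , refl)) ne = cong not (eqb-false (ne ∘ sym))

walk-crosses : ∀ {G : Graph N} {T q} (lab : Fin N → Fin q) {u w} → Reach G T u w → lab u ≢ lab w →
               Σ (EdgeIx G) λ i → (crosses lab (lookup (E G) i) ∧ T i) ≡ true
walk-crosses lab here ne = ⊥-elim (ne refl)
walk-crosses {G = G} lab {u} (step {w = x} i Ti adj walk) ne with lab u ≟ lab x
... | yes eq  = walk-crosses lab walk (ne ∘ trans eq)
... | no  ne′ = i , ∧-intro (adjacent-crosses lab (lookup (E G) i) adj ne′) Ti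

module Merge {q : ℕ} (i j : Fin (suc q)) (i≢j : i ≢ j) where

  merge : Fin (suc q) → Fin q
  merge x with j ≟ x
  ... | yes _   = punchOut (i≢j ∘ sym)
  ... | no  j≢x = punchOut j≢x

  merge-identifies : merge i ≡ merge j
  merge-identifies with j ≟ i | j ≟ j
  ... | yes j≡i | _     = contradiction (sym j≡i) i≢j
  ... | no  _   | yes _ = punchOut-cong j refl
  ... | no  _   | no  j≢j = contradiction refl j≢j

  merge-punchIn : ∀ y → merge (punchIn j y) ≡ y
  merge-punchIn y with j ≟ punchIn j y
  ... | yes j≡ = contradiction (sym j≡) (punchInᵢ≢i j y)
  ... | no  _  = trans (punchOut-cong j refl) (punchOut-punchIn j)

-- A walk between two classes contains a tree edge joining two classes; merging those two
-- classes keeps every other crossing tree edge and loses this one.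
connected⇒labels≤1+crossing :
  ∀ {G : Graph N} {T} → Connected G T →
  ∀ q (lab : Fin N → Fin q) → (∀ y → Σ (Fin N) λ v → V G v ≡ true × lab v ≡ y) →
  q ≤ suc (countB (λ i → crosses lab (lookup (E G) i) ∧ T i) (allFin (length (E G))))
connected⇒labels≤1+crossing conn zero          lab onto = z≤n
connected⇒labels≤1+crossing conn (suc zero)    lab onto = s≤s z≤n
connected⇒labels≤1+crossing {N} {G} {T} conn (suc (suc q)) lab onto =
  s≤s (≤-trans (connected⇒labels≤1+crossing conn (suc q) (merge ∘ lab) onto′) fewer)
  where
  idx : List (EdgeIx G)
  idx = allFin (length (E G))
  crossingTree : ∀ {r} → (Fin N → Fin r) → EdgeIx G → Bool
  crossingTree ℓ i = crosses ℓ (lookup (E G) i) ∧ T i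

  found : Σ (EdgeIx G) λ i → crossingTree lab i ≡ true
  found with onto zero | onto (suc zero)
  ... | u , u∈G , lu≡0 | w , w∈G , lw≡1 =
    walk-crosses lab (conn u w u∈G w∈G) (λ eq → contradiction (trans (sym lu≡0) (trans eq lw≡1)) λ ())
  i : EdgeIx G
  i = proj₁ found
  a b : Fin N
  a = proj₁ (lookup (E G) i)
  b = proj₂ (lookup (E G) i)

  la≢lb : lab a ≢ lab b
  la≢lb eq = contradiction (trans (sym (∧-conicalˡ _ _ (proj₂ found)))
                                  (crosses-≡ {lab = lab} {e = lookup (E G) i} eq)) λ ()

  open Merge (lab a) (lab b) la≢lb

  onto′ : ∀ y → Σ (Fin N) λ v → V G v ≡ true × merge (lab v) ≡ y
  onto′ y with onto (punchIn (lab b) y)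
  ... | v , v∈G , lv = v , v∈G , trans (cong merge lv) (merge-punchIn y)

  fewer : suc (countB (crossingTree (merge ∘ lab)) idx) ≤ countB (crossingTree lab) idx
  fewer = countB-strict idx still-crossing (∈-allFin i) (proj₂ found) merged
    where
    still-crossing : ∀ i′ → crossingTree (merge ∘ lab) i′ ≡ true → crossingTree lab i′ ≡ true
    still-crossing i′ h = ∧-intro (crosses-∘ merge lab _ (∧-conicalˡ _ _ h)) (∧-conicalʳ _ _ h)
    merged : crossingTree (merge ∘ lab) i ≡ false
    merged = cong (_∧ T i) (crosses-≡ {lab = merge ∘ lab} {e = lookup (E G) i} merge-identifies)

partIndex : (X : VSet N) (Xs : List (VSet N)) → Fin N → Fin (length (X ∷ Xs))
partIndex X []       v = zero
partIndex X (Y ∷ Ys) v = if X v then zero else suc (partIndex Y Ys v)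

partIndex-lookup : ∀ (X : VSet N) Xs y v → lookup (X ∷ Xs) y v ≡ true → cover (X ∷ Xs) v ≤ 1 →
                   partIndex X Xs v ≡ y
partIndex-lookup X []       zero    v _  _ = refl
partIndex-lookup X (Y ∷ Ys) zero    v Xv _ rewrite Xv = refl
partIndex-lookup X (Y ∷ Ys) (suc y) v Zv cover≤1 with X v
... | true  = contradiction (≤-trans (s≤s (lookup⇒1≤countB (λ Z → Z v) (Y ∷ Ys) y Zv)) cover≤1) λ { (s≤s ()) }
... | false = cong suc (partIndex-lookup Y Ys y v Zv cover≤1)

partIndex-crosses : ∀ (X : VSet N) Xs → (∀ v → cover (X ∷ Xs) v ≤ 1) →
                    ∀ e → crosses (partIndex X Xs) e ≡ true → crossing (X ∷ Xs) e ≡ true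
partIndex-crosses X Xs cover≤1 e h with any (λ Z → inside Z e) (X ∷ Xs) in some
... | false = refl
... | true with any⇒lookup (λ Z → inside Z e) (X ∷ Xs) some
... | y , Zy = contradiction (trans (sym h) (crosses-≡ {lab = partIndex X Xs} {e = e} same)) λ ()
  where
  same : partIndex X Xs (proj₁ e) ≡ partIndex X Xs (proj₂ e)
  same = trans (partIndex-lookup X Xs y _ (∧-conicalˡ _ _ Zy) (cover≤1 _))
               (sym (partIndex-lookup X Xs y _ (∧-conicalʳ _ _ Zy) (cover≤1 _)))

connected⇒parts≤1+crossing :
  ∀ {G : Graph N} {T} → Connected G T →
  ∀ Qs → All (Meets G) Qs → (∀ v → cover Qs v ≤ 1) →
  length Qs ≤ suc (countB (λ i → crossing Qs (lookup (E G) i) ∧ T i) (allFin (length (E G))))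
connected⇒parts≤1+crossing conn [] _ _ = z≤n
connected⇒parts≤1+crossing {G = G} {T} conn (X ∷ Xs) meets cover≤1 =
  ≤-trans (connected⇒labels≤1+crossing conn _ (partIndex X Xs) onto)
          (s≤s (countB-mono (allFin (length (E G))) fewer))
  where
  onto : ∀ y → Σ _ λ v → V G v ≡ true × partIndex X Xs v ≡ y
  onto y with lookupᴬ meets y
  ... | v , Zv , v∈G = v , v∈G , partIndex-lookup X Xs y v Zv (cover≤1 v)
  fewer : ∀ i → (crosses (partIndex X Xs) (lookup (E G) i) ∧ T i) ≡ true →
                (crossing (X ∷ Xs) (lookup (E G) i) ∧ T i) ≡ true
  fewer i h = ∧-intro (partIndex-crosses X Xs cover≤1 _ (∧-conicalˡ _ _ h)) (∧-conicalʳ _ _ h)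

-- Tree-connected graphs and their component partitions

-- TreeConnected keeps its trees only in the indices of the spanning-tree proofs.
spanningTreeEdges : ∀ {G : Graph N} {T} → IsSpanningTree G T → EdgeIx G → Bool
spanningTreeEdges {T = T} _ = T

treeEdges : ∀ {G : Graph N} → TreeConnected k G → Fin k → EdgeIx G → Bool
treeEdges (_ , trees) j = spanningTreeEdges (trees j)

treeEdges-disjoint : ∀ {G : Graph N} (tc : TreeConnected k G) i → countB (λ j → treeEdges tc j i) (allFin k) ≤ 1
treeEdges-disjoint {k = k} (c , _) i with c i
... | nothing = ≤-trans (≤-reflexive (countB≡0 (allFin k) (λ _ → refl))) z≤n
... | just j  = ≤-reflexive (countB-eqb (λ _ → true) j)

∑-treeEdges≤ : ∀ {G : Graph N} (tc : TreeConnected k G) (p : EdgeIx G → Bool) →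
               ∑ (λ j → countB (λ i → p i ∧ treeEdges tc j i) (allFin (length (E G)))) (allFin k)
                 ≤ countB p (allFin (length (E G)))
∑-treeEdges≤ {k = k} {G = G} tc p = begin
  ∑ (λ j → countB (λ i → p i ∧ treeEdges tc j i) idx) (allFin k)  ≡⟨ countB-comm _ (allFin k) idx ⟩
  ∑ (λ i → countB (λ j → p i ∧ treeEdges tc j i) (allFin k)) idx  ≤⟨ ∑-mono idx at-most-one ⟩
  ∑ (𝟙 ∘ p) idx                                                    ≡⟨ countB≡∑ p idx ⟨
  countB p idx                                                     ∎
  where
  open ≤-Reasoning
  idx : List (EdgeIx G)
  idx = allFin (length (E G))
  at-most-one : ∀ i → countB (λ j → p i ∧ treeEdges tc j i) (allFin k) ≤ 𝟙 (p i)
  at-most-one i with p i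
  ... | true  = treeEdges-disjoint tc i
  ... | false = ≤-reflexive (countB≡0 (allFin k) (λ _ → refl))

∑-allFin-const : ∀ k c → ∑ (λ _ → c) (allFin k) ≡ c * k
∑-allFin-const k c = trans (∑-const c (allFin k)) (cong (c *_) (length-allFin k))

treeConnected⇒size : ∀ {H : Graph N} → TreeConnected m H → m * size (V H) ≤ m + length (E H)
treeConnected⇒size {m = m} {H} tc@(_ , trees) = begin
  m * size (V H)
    ≡⟨ *-comm m _ ⟩
  size (V H) * m
    ≡⟨ ∑-allFin-const m (size (V H)) ⟨
  ∑ (λ _ → size (V H)) (allFin m)
    ≡⟨ ∑-cong (allFin m) (λ j → trans (+-comm 1 _) (proj₂ (trees j))) ⟨
  ∑ (λ j → 1 + countTrue (treeEdges tc j)) (allFin m)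
    ≡⟨ ∑-+ (allFin m) ⟩
  ∑ (λ _ → 1) (allFin m) + ∑ (λ j → countTrue (treeEdges tc j)) (allFin m)
    ≤⟨ +-mono-≤ (≤-reflexive (trans (∑-1 (allFin m)) (length-allFin m))) (∑-treeEdges≤ tc (λ _ → true)) ⟩
  m + countB (λ _ → true) idx
    ≡⟨ cong (m +_) (trans (countB≡∑ _ idx) (trans (∑-1 idx) (length-allFin _))) ⟩
  m + length (E H)
    ∎
  where
  open ≤-Reasoning
  idx : List (EdgeIx H)
  idx = allFin (length (E H))

treeConnected⇒crossEdges : ∀ (G : Graph N) → TreeConnected k G →
  ∀ Qs → All (Meets G) Qs → (∀ v → cover Qs v ≤ 1) → k * length Qs ≤ k + crossEdges G Qs
treeConnected⇒crossEdges {k = k} G tc@(_ , trees) Qs meets cover≤1 = begin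
  k * length Qs                               ≡⟨ *-comm k _ ⟩
  length Qs * k                               ≡⟨ ∑-allFin-const k (length Qs) ⟨
  ∑ (λ _ → length Qs) (allFin k)              ≤⟨ ∑-mono (allFin k) (λ j →
                                                   connected⇒parts≤1+crossing (proj₁ (trees j)) Qs meets cover≤1) ⟩
  ∑ (λ j → 1 + countB (λ i → cr i ∧ treeEdges tc j i) idx) (allFin k)
                                              ≡⟨ ∑-+ (allFin k) ⟩
  ∑ (λ _ → 1) (allFin k) + ∑ (λ j → countB (λ i → cr i ∧ treeEdges tc j i) idx) (allFin k)
                                              ≤⟨ +-mono-≤ (≤-reflexive (trans (∑-1 (allFin k)) (length-allFin k)))
                                                          (∑-treeEdges≤ tc cr) ⟩
  k + countB cr idx                           ≡⟨ cong (k +_) (countB-lookup (crossing Qs) (E G)) ⟩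
  k + crossEdges G Qs                         ∎
  where
  open ≤-Reasoning
  idx : List (EdgeIx G)
  idx = allFin (length (E G))
  cr : EdgeIx G → Bool
  cr i = crossing Qs (lookup (E G) i)

component⇒size : ∀ {H : Graph N} {X} → IsComponent m H X → m * size X ≤ m + countB (inside X) (E H)
component⇒size {m = m} {H} {X} (X⊆V , _ , tc , _) =
  subst₂ (λ s e → m * s ≤ m + e) (size-∧ X⊆V) (length-filterB (inside X) (E H)) (treeConnected⇒size tc)

∑inside+crossing≤length : ∀ {Xs : List (VSet N)} → (∀ v → cover Xs v ≤ 1) →
  ∀ es → ∑ (λ X → countB (inside X) es) Xs + countB (crossing Xs) es ≤ length es
∑inside+crossing≤length {Xs = Xs} cover≤1 es = begin
  ∑ (λ X → countB (inside X) es) Xs + countB (crossing Xs) es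
    ≡⟨ cong₂ _+_ (countB-comm (λ X e → inside X e) Xs es) (countB≡∑ (crossing Xs) es) ⟩
  ∑ (λ e → countB (λ X → inside X e) Xs) es + ∑ (𝟙 ∘ crossing Xs) es
    ≡⟨ ∑-+ es ⟨
  ∑ (λ e → countB (λ X → inside X e) Xs + 𝟙 (crossing Xs e)) es
    ≤⟨ ∑-mono es (λ e → countB+𝟙¬any≤1 (λ X → inside X e) Xs
                          (≤-trans (countB-mono Xs (λ X → ∧-conicalˡ _ _)) (cover≤1 (proj₁ e)))) ⟩
  ∑ (λ _ → 1) es
    ≡⟨ ∑-1 es ⟩
  length es ∎
  where open ≤-Reasoning

module Partition {m : ℕ} (H : Graph N) {Xs : List (VSet N)} (P : IsComponentPartition m H Xs) where

  cover≡𝟙 : ∀ v → cover Xs v ≡ 𝟙 (V H v)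
  cover≡𝟙 v with V H v in v∈H
  ... | true  = proj₂ P v v∈H
  ... | false = uncovered (proj₁ P)
    where
    uncovered : ∀ {Ys} → All (IsComponent m H) Ys → cover Ys v ≡ 0
    uncovered []                   = refl
    uncovered {Y ∷ _} ((Y⊆V , _) ∷ cs) with Y v in Yv
    ... | true  = contradiction (trans (sym (Y⊆V v Yv)) v∈H) λ ()
    ... | false = uncovered cs

  cover≤1 : ∀ v → cover Xs v ≤ 1
  cover≤1 v = ≤-trans (≤-reflexive (cover≡𝟙 v)) (𝟙≤1 (V H v))

  ∑size : ∑ size Xs ≡ size (V H)
  ∑size = begin
    ∑ size Xs                     ≡⟨ countB-comm (λ X v → X v) Xs (allFin N) ⟩
    ∑ (cover Xs) (allFin N)       ≡⟨ ∑-cong (allFin N) cover≡𝟙 ⟩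
    ∑ (𝟙 ∘ V H) (allFin N)        ≡⟨ countB≡∑ (V H) (allFin N) ⟨
    size (V H)                    ∎
    where open ≡-Reasoning

  Ω-lowerBound : m * size (V H) + crossEdges H Xs ≤ m * length Xs + length (E H)
  Ω-lowerBound = begin
    m * size (V H) + cross                               ≡⟨ cong (λ n → m * n + cross) ∑size ⟨
    m * ∑ size Xs + cross                                ≡⟨ cong (_+ cross) (∑-*ˡ m size Xs) ⟨
    ∑ (λ X → m * size X) Xs + cross
                                                         ≤⟨ +-monoˡ-≤ cross (∑-monoᴬ (All.map (component⇒size {H = H}) (proj₁ P))) ⟩
    ∑ (λ X → m + countB (inside X) (E H)) Xs + cross     ≡⟨ cong (_+ cross) (∑-+ Xs) ⟩
    ∑ (λ _ → m) Xs + ∑ (λ X → countB (inside X) (E H)) Xs + cross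
                                                         ≡⟨ +-assoc (∑ (λ _ → m) Xs) _ cross ⟩
    ∑ (λ _ → m) Xs + (∑ (λ X → countB (inside X) (E H)) Xs + cross)
                                                         ≤⟨ +-mono-≤ (≤-reflexive (∑-const m Xs))
                                                                     (∑inside+crossing≤length {Xs = Xs} cover≤1 (E H)) ⟩
    m * length Xs + length (E H)                         ∎
    where
    open ≤-Reasoning
    cross : ℕ
    cross = crossEdges H Xs

-- Edges meeting S

≤-from-+≡ : ∀ {c d a b x y} → c + d ≡ a + b → a ≤ x → b ≤ y → c ≤ x + y
≤-from-+≡ {c} {d} eq a≤x b≤y = ≤-trans (m≤m+n c d) (≤-trans (≤-reflexive eq) (+-mono-≤ a≤x b≤y))

-- For one edge: sa, sb say whether its ends lie in S, an whether it lies inside a part, c₁ counts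
-- the parts it leaves and c₂ the parts containing both ends.
cut-arith : ∀ (sa sb an : Bool) {c₁ c₂ ca cb : ℕ} → c₁ + 2 * c₂ ≡ ca + cb →
            ca ≤ 𝟙 (not sa) → cb ≤ 𝟙 (not sb) → (an ≡ true → 1 ≤ c₂) →
            c₁ + 2 * 𝟙 (sa ∧ sb) ≤ 2 * 𝟙 ((not sa ∧ not sb) ∧ not an) + (𝟙 sa + 𝟙 sb)
cut-arith true  true  _     eq ca≤ cb≤ _ = +-monoˡ-≤ 2 (≤-from-+≡ eq ca≤ cb≤)
cut-arith true  false _     eq ca≤ cb≤ _ = +-monoˡ-≤ 0 (≤-from-+≡ eq ca≤ cb≤)
cut-arith false true  _     eq ca≤ cb≤ _ = +-monoˡ-≤ 0 (≤-from-+≡ eq ca≤ cb≤)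
cut-arith false false false eq ca≤ cb≤ _ = +-monoˡ-≤ 0 (≤-from-+≡ eq ca≤ cb≤)
cut-arith false false true {c₁} eq ca≤ cb≤ an⇒ = +-monoˡ-≤ 0 (+-cancelʳ-≤ 2 c₁ 0
  (≤-trans (+-monoʳ-≤ c₁ (*-monoʳ-≤ 2 (an⇒ refl))) (≤-trans (≤-reflexive eq) (+-mono-≤ ca≤ cb≤))))

∑cutSize≤ : ∀ (G : Graph N) (S : VSet N) Xs → (∀ v → cover Xs v ≤ 𝟙 (not (S v))) →
  ∑ (cutSize G) Xs + 2 * countB (inside S) (E G)
    ≤ 2 * countB (λ e → inside (not ∘ S) e ∧ crossing Xs e) (E G) + ∑ (ends S) (E G)
∑cutSize≤ G S Xs cover≤ = begin
  ∑ (cutSize G) Xs + 2 * countB (inside S) (E G)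
    ≡⟨ cong₂ _+_ (countB-comm (λ X e → X (proj₁ e) xor X (proj₂ e)) Xs (E G))
                 (sym (∑-*𝟙 2 (inside S) (E G))) ⟩
  ∑ (λ e → countB (λ X → X (proj₁ e) xor X (proj₂ e)) Xs) (E G) + ∑ (λ e → 2 * 𝟙 (inside S e)) (E G)
    ≤⟨ ∑-mono₂ (E G) per-edge ⟩
  ∑ (λ e → 2 * 𝟙 (inside (not ∘ S) e ∧ crossing Xs e)) (E G) + ∑ (ends S) (E G)
    ≡⟨ cong (_+ ∑ (ends S) (E G)) (∑-*𝟙 2 _ (E G)) ⟩
  2 * countB (λ e → inside (not ∘ S) e ∧ crossing Xs e) (E G) + ∑ (ends S) (E G) ∎
  where
  open ≤-Reasoning
  per-edge : ∀ e → countB (λ X → X (proj₁ e) xor X (proj₂ e)) Xs + 2 * 𝟙 (inside S e)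
                   ≤ 2 * 𝟙 (inside (not ∘ S) e ∧ crossing Xs e) + ends S e
  per-edge (a , b) = cut-arith (S a) (S b) _ {c₁ = countB (λ X → X a xor X b) Xs}
                       (countB-xor (λ X → X a) (λ X → X b) Xs)
                       (cover≤ a) (cover≤ b) (any⇒1≤countB (λ X → inside X (a , b)) Xs)

crossing-arith : ∀ (sa sb an an′ : Bool) →
                 𝟙 (not (an ∨ an′)) + 𝟙 (sa ∧ sb) ≤ 𝟙 ((not sa ∧ not sb) ∧ not an) + (𝟙 sa + 𝟙 sb)
crossing-arith true  true  _     _ = +-monoˡ-≤ 1 (𝟙≤1 _)
crossing-arith true  false _     _ = +-monoˡ-≤ 0 (𝟙≤1 _)
crossing-arith false true  _     _ = +-monoˡ-≤ 0 (𝟙≤1 _)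
crossing-arith false false true  _ = z≤n
crossing-arith false false false _ = +-monoˡ-≤ 0 (𝟙≤1 _)

crossEdges-++≤ : ∀ (G : Graph N) (S : VSet N) Xs Ys →
  crossEdges G (Xs ++ Ys) + countB (inside S) (E G)
    ≤ countB (λ e → inside (not ∘ S) e ∧ crossing Xs e) (E G) + ∑ (ends S) (E G)
crossEdges-++≤ G S Xs Ys =
  subst₂ _≤_ (sym (cong₂ _+_ (countB≡∑ _ (E G)) (countB≡∑ _ (E G))))
             (sym (cong (_+ ∑ (ends S) (E G)) (countB≡∑ _ (E G))))
             (∑-mono₂ (E G) per-edge)
  where
  per-edge : ∀ e → 𝟙 (crossing (Xs ++ Ys) e) + 𝟙 (inside S e)
                   ≤ 𝟙 (inside (not ∘ S) e ∧ crossing Xs e) + ends S e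
  per-edge (a , b) rewrite any-++ (λ X → inside X (a , b)) Xs Ys = crossing-arith (S a) (S b) _ _

handshake : ∀ {G : Graph N} → WF G → ∀ S → ∑ (deg G) (filterB S (allFin N)) ≡ ∑ (ends S) (E G)
handshake {N} {G} wf S = begin
  ∑ (deg G) Svs                                                  ≡⟨ countB-comm incident Svs (E G) ⟩
  ∑ (λ e → countB (λ v → incident v e) Svs) (E G)                ≡⟨ ∑-congᴬ (All.map (ends-count ∘ proj₁) wf) ⟩
  ∑ (ends S) (E G)                                               ∎
  where
  open ≡-Reasoning
  Svs : List (Fin N)
  Svs = filterB S (allFin N)
  incident : Fin N → Edge N → Bool
  incident v e = eqb (proj₁ e) v ∨ eqb (proj₂ e) v
  ends-count : ∀ {e} → proj₁ e ≢ proj₂ e → countB (λ v → incident v e) Svs ≡ ends S e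
  ends-count {e} a≢b = trans (countB-∨ Svs (eqb-disjoint a≢b))
                             (cong₂ _+_ (countB-eqb-filterB S (proj₁ e)) (countB-eqb-filterB S (proj₂ e)))

edgeConnected⇒∑cutSize : ∀ (G : Graph N) {v₀} → EdgeConnected k G → V G v₀ ≡ true →
  ∀ {Xs} → All (λ X → X ⊆ V G × Σ (Fin N) (λ u → X u ≡ true) × X v₀ ≡ false) Xs →
  k * length Xs ≤ ∑ (cutSize G) Xs
edgeConnected⇒∑cutSize {k = k} G {v₀} ec v₀∈G {Xs} parts =
  subst (_≤ ∑ (cutSize G) Xs) (∑-const k Xs)
        (∑-monoᴬ (All.map (λ (X⊆V , nonempty , v₀∉X) → ec _ X⊆V nonempty (v₀ , v₀∈G , v₀∉X)) parts))

edge-arith : ∀ m k p₁ p₂ s E₁ E₂ eS D {C} →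
  2 * m ≤ k → k * p₁ ≤ C → C + 2 * eS ≤ 2 * E₁ + D → m * s + E₂ ≤ m * p₂ + eS →
  k * (m * p₁) + (s * (m * (2 * m)) + 2 * m * E₂) ≤ (m * D + 2 * m * (m * p₂)) + k * E₁
edge-arith m k p₁ p₂ s E₁ E₂ eS D 2m≤k cuts cuts≤ inner =
  +-cancelʳ-≤ (m * (2 * eS)) _ _ (begin
    k * (m * p₁) + (s * (m * (2 * m)) + 2 * m * E₂) + m * (2 * eS)   ≡⟨ regroupˡ m k p₁ s E₂ eS ⟩
    m * (k * p₁ + 2 * eS) + 2 * m * (m * s + E₂)
      ≤⟨ +-mono-≤ (*-monoʳ-≤ m (≤-trans (+-monoˡ-≤ (2 * eS) cuts) cuts≤)) (*-monoʳ-≤ (2 * m) inner) ⟩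
    m * (2 * E₁ + D) + 2 * m * (m * p₂ + eS)                          ≡⟨ regroupʳ m E₁ D p₂ eS ⟩
    (m * D + 2 * m * (m * p₂)) + 2 * m * E₁ + m * (2 * eS)
      ≤⟨ +-monoˡ-≤ (m * (2 * eS)) (+-monoʳ-≤ (m * D + 2 * m * (m * p₂)) (*-monoˡ-≤ E₁ 2m≤k)) ⟩
    (m * D + 2 * m * (m * p₂)) + k * E₁ + m * (2 * eS)               ∎)
  where
  open ≤-Reasoning
  regroupˡ : ∀ m k p s e f → k * (m * p) + (s * (m * (2 * m)) + 2 * m * e) + m * (2 * f)
                             ≡ m * (k * p + 2 * f) + 2 * m * (m * s + e)
  regroupˡ = solve-∀ℕ
  regroupʳ : ∀ m e d p f → m * (2 * e + d) + 2 * m * (m * p + f) ≡ (m * d + 2 * m * (m * p)) + 2 * m * e + m * (2 * f)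
  regroupʳ = solve-∀ℕ

tree-arith : ∀ m k p₁ p₂ s E₁ E₂ eS D {X} →
  m ≤ k → k * (p₁ + s) ≤ k + X → X + eS ≤ E₁ + D → m * s + E₂ ≤ m * p₂ + eS →
  k * (m * p₁) + (s * (m * m + k * m) + m * E₂) ≤ (m * D + k * m + m * (m * p₂)) + k * E₁
tree-arith m k p₁ p₂ s E₁ E₂ eS D {X} m≤k trees X≤ inner =
  +-cancelʳ-≤ (m * eS) _ _ (begin
    k * (m * p₁) + (s * (m * m + k * m) + m * E₂) + m * eS    ≡⟨ regroupˡ m k p₁ s E₂ eS ⟩
    m * (k * (p₁ + s) + eS) + m * (m * s + E₂)
      ≤⟨ +-mono-≤ (*-monoʳ-≤ m (≤-trans (+-monoˡ-≤ eS trees)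
                                  (≤-trans (≤-reflexive (+-assoc k X eS)) (+-monoʳ-≤ k X≤))))
                  (*-monoʳ-≤ m inner) ⟩
    m * (k + (E₁ + D)) + m * (m * p₂ + eS)                    ≡⟨ regroupʳ m k E₁ D p₂ eS ⟩
    (m * D + k * m + m * (m * p₂)) + m * E₁ + m * eS
      ≤⟨ +-monoˡ-≤ (m * eS) (+-monoʳ-≤ (m * D + k * m + m * (m * p₂)) (*-monoˡ-≤ E₁ m≤k)) ⟩
    (m * D + k * m + m * (m * p₂)) + k * E₁ + m * eS          ∎)
  where
  open ≤-Reasoning
  regroupˡ : ∀ m k p s e f → k * (m * p) + (s * (m * m + k * m) + m * e) + m * f
                             ≡ m * (k * (p + s) + f) + m * (m * s + e)
  regroupˡ = solve-∀ℕ
  regroupʳ : ∀ m k e d p f → m * (k + (e + d)) + m * (m * p + f) ≡ (m * d + k * m + m * (m * p)) + m * e + m * f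
  regroupʳ = solve-∀ℕ

open import Data.Integer using (+_)

diff-≤-diff : ∀ p q r t → p + t ≤ r + q → + p - + q ℤ.≤ + r - + t
diff-≤-diff p q r t le =
  subst₂ ℤ._≤_ (cancelˡ (+ p) (+ t) (+ q)) (cancelʳ (+ r) (+ q) (+ t))
    (ℤP.+-monoˡ-≤ (ℤ.- + q - + t) (subst₂ ℤ._≤_ (ℤP.pos-+ p t) (ℤP.pos-+ r q) (+≤+ le)))
  where
  cancelˡ : ∀ x y z → (x ℤ.+ y) ℤ.+ (ℤ.- z - y) ≡ x - z
  cancelˡ = solve-∀
  cancelʳ : ∀ x y z → (x ℤ.+ y) ℤ.+ (ℤ.- y - z) ≡ x - z
  cancelʳ = solve-∀

*-diff : ∀ c a b → + c ℤ.* (+ a - + b) ≡ + (c * a) - + (c * b)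
*-diff c a b = trans (distrib (+ c) (+ a) (+ b)) (sym (cong₂ _-_ (ℤP.pos-* c a) (ℤP.pos-* c b)))
  where
  distrib : ∀ x y z → x ℤ.* (y - z) ≡ x ℤ.* y - x ℤ.* z
  distrib = solve-∀

diff-+-diff : ∀ a b c d → (+ a - + b) ℤ.+ (+ c - + d) ≡ + (a + c) - + (b + d)
diff-+-diff a b c d = trans (regroup (+ a) (+ b) (+ c) (+ d)) (sym (cong₂ _-_ (ℤP.pos-+ a c) (ℤP.pos-+ b d)))
  where
  regroup : ∀ w x y z → (w - x) ℤ.+ (y - z) ≡ (w ℤ.+ y) - (x ℤ.+ z)
  regroup = solve-∀

diff-+ : ∀ a b c → (+ a - + b) ℤ.+ + c ≡ + (a + c) - + b
diff-+ a b c = trans (regroup (+ a) (+ b) (+ c)) (sym (cong (_- + b) (ℤP.pos-+ a c)))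
  where
  regroup : ∀ x y z → (x - y) ℤ.+ z ≡ (x ℤ.+ z) - y
  regroup = solve-∀

diff-diff : ∀ a b c → (+ a - + b) - + c ≡ + a - + (b + c)
diff-diff a b c = trans (regroup (+ a) (+ b) (+ c)) (sym (cong (+ a -_) (ℤP.pos-+ b c)))
  where
  regroup : ∀ x y z → (x - y) - z ≡ x - (y ℤ.+ z)
  regroup = solve-∀

sumOver-∑ : (S : VSet N) (f : Fin N → ℤ) (a b : Fin N → ℕ) → (∀ v → f v ≡ + a v - + b v) →
            sumOver S f ≡ + ∑ a (filterB S (allFin N)) - + ∑ b (filterB S (allFin N))
sumOver-∑ {N} S f a b f≡ = go (allFin N)
  where
  go : ∀ vs → foldr (λ v acc → (if S v then f v else + 0) ℤ.+ acc) (+ 0) vs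
              ≡ + ∑ a (filterB S vs) - + ∑ b (filterB S vs)
  go []       = refl
  go (v ∷ vs) with S v
  ... | true  = trans (cong₂ ℤ._+_ (f≡ v) (go vs)) (diff-+-diff (a v) (b v) _ _)
  ... | false = trans (ℤP.+-identityˡ _) (go vs)

module Split {m : ℕ} {G : Graph N} (wf : WF G) (S : VSet N) (S⊆V : S ⊆ V G) {Xs₁ Xs₂ : List (VSet N)}
             (P₁ : IsComponentPartition m (G ∖ S) Xs₁) (P₂ : IsComponentPartition m (G [ S ]) Xs₂) where

  Svs : List (Fin N)
  Svs = filterB S (allFin N)

  p₁ p₂ s E₁ E₂ eS D : ℕ
  p₁ = length Xs₁
  p₂ = length Xs₂
  s  = size S
  E₁ = crossEdges (G ∖ S) Xs₁
  E₂ = crossEdges (G [ S ]) Xs₂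
  eS = countB (inside S) (E G)
  D  = ∑ (ends S) (E G)

  E₁≡ : E₁ ≡ countB (λ e → inside (not ∘ S) e ∧ crossing Xs₁ e) (E G)
  E₁≡ = countB-filterB (crossing Xs₁) (inside (not ∘ S)) (E G)

  cover-outside : ∀ v → cover Xs₁ v ≤ 𝟙 (not (S v))
  cover-outside v = ≤-trans (≤-reflexive (Partition.cover≡𝟙 (G ∖ S) P₁ v)) (𝟙-∧≤ʳ (V G v) (not (S v)))

  inner : m * s + E₂ ≤ m * p₂ + eS
  inner = subst₂ (λ n e → m * n + E₂ ≤ m * p₂ + e) (size-∧ S⊆V) (length-filterB (inside S) (E G))
                 (Partition.Ω-lowerBound (G [ S ]) P₂)

  sumOver-split : ∀ c (f : Fin N → ℤ) → (∀ v → f v ≡ + (m * deg G v) - + c) →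
                  sumOver S f ≡ + (m * D) - + (s * c)
  sumOver-split c f f≡ =
    trans (sumOver-∑ S f (λ v → m * deg G v) (λ _ → c) f≡) (cong₂ _-_ (cong +_ degrees) (cong +_ constants))
    where
    degrees : ∑ (λ v → m * deg G v) Svs ≡ m * D
    degrees = trans (∑-*ˡ m (deg G) Svs) (cong (m *_) (handshake wf S))
    constants : ∑ (λ _ → c) Svs ≡ s * c
    constants = trans (∑-const c Svs) (trans (cong (c *_) (length-filterB S (allFin N))) (*-comm c s))

  Qs : List (VSet N)
  Qs = Xs₁ ++ map ⦅_⦆ Svs

  length-Qs : length Qs ≡ p₁ + s
  length-Qs = trans (length-++ Xs₁) (cong (_+_ p₁) (trans (length-map ⦅_⦆ Svs) (length-filterB S (allFin N))))

  Qs-meet : All (Meets G) Qs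
  Qs-meet = ++⁺ (All.map (λ (X⊆ , (u , Xu) , _) → u , Xu , ∧-conicalˡ _ _ (X⊆ u Xu)) (proj₁ P₁))
                (map⁺ (All.map (λ {t} t∈S → t , eqb-refl t , S⊆V t t∈S) (filterB-sound S (allFin N))))

  Qs-cover≤1 : ∀ v → cover Qs v ≤ 1
  Qs-cover≤1 v = begin
    cover Qs v                               ≡⟨ countB-++ (λ X → X v) Xs₁ (map ⦅_⦆ Svs) ⟩
    cover Xs₁ v + cover (map ⦅_⦆ Svs) v      ≡⟨ cong (_+_ (cover Xs₁ v)) singletons ⟩
    cover Xs₁ v + 𝟙 (S v)                    ≤⟨ +-monoˡ-≤ (𝟙 (S v)) (cover-outside v) ⟩
    𝟙 (not (S v)) + 𝟙 (S v)                  ≡⟨ 𝟙-not+𝟙 (S v) ⟩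
    1                                        ∎
    where
    open ≤-Reasoning
    singletons : cover (map ⦅_⦆ Svs) v ≡ 𝟙 (S v)
    singletons = trans (countB-map (λ X → X v) ⦅_⦆ Svs) (countB-eqb-filterB S v)

Ω-bound-edgeConnected : ∀ m k {N} (G : Graph N) → WF G → (S : VSet N) → S ⊆ V G →
  EdgeConnected k G → 2 * m ≤ k → (Σ (Fin N) λ u → S u ≡ true) →
  (ω₁ ω₂ : ℤ) → IsOmega m (G ∖ S) ω₁ → IsOmega m (G [ S ]) ω₂ →
  + k ℤ.* ω₁ ℤ.≤ sumOver S (λ v → + m ℤ.* (+ deg G v - + (2 * m))) ℤ.+ + (2 * m) ℤ.* ω₂
Ω-bound-edgeConnected m k G wf S S⊆V ec 2m≤k (s₀ , s₀∈S) _ _ (Xs₁ , P₁ , refl) (Xs₂ , P₂ , refl) = begin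
  + k ℤ.* (+ (m * p₁) - + E₁)
    ≡⟨ *-diff k (m * p₁) E₁ ⟩
  + (k * (m * p₁)) - + (k * E₁)
    ≤⟨ diff-≤-diff _ _ (m * D + 2 * m * (m * p₂)) (s * (m * (2 * m)) + 2 * m * E₂)
                   (edge-arith m k p₁ p₂ s E₁ E₂ eS D 2m≤k cuts cuts≤ inner) ⟩
  + (m * D + 2 * m * (m * p₂)) - + (s * (m * (2 * m)) + 2 * m * E₂)
    ≡⟨ diff-+-diff (m * D) (s * (m * (2 * m))) (2 * m * (m * p₂)) (2 * m * E₂) ⟨
  (+ (m * D) - + (s * (m * (2 * m)))) ℤ.+ (+ (2 * m * (m * p₂)) - + (2 * m * E₂))
    ≡⟨ cong₂ ℤ._+_ (sumOver-split (m * (2 * m)) _ (λ v → *-diff m (deg G v) (2 * m)))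
                   (*-diff (2 * m) (m * p₂) E₂) ⟨
  sumOver S (λ v → + m ℤ.* (+ deg G v - + (2 * m))) ℤ.+ + (2 * m) ℤ.* (+ (m * p₂) - + E₂) ∎
  where
  open ℤP.≤-Reasoning
  open Split wf S S⊆V P₁ P₂

  outside-part : ∀ {X} → IsComponent m (G ∖ S) X → X ⊆ V G × Σ _ (λ u → X u ≡ true) × X s₀ ≡ false
  outside-part {X} (X⊆ , nonempty , _) = (λ v → ∧-conicalˡ _ _ ∘ X⊆ v) , nonempty , s₀∉X
    where
    s₀∉X : X s₀ ≡ false
    s₀∉X with X s₀ in Xs₀
    ... | false = refl
    ... | true  = contradiction (trans (sym (cong not s₀∈S)) (∧-conicalʳ _ _ (X⊆ s₀ Xs₀))) λ ()

  cuts : k * p₁ ≤ ∑ (cutSize G) Xs₁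
  cuts = edgeConnected⇒∑cutSize G ec (S⊆V s₀ s₀∈S) (All.map outside-part (proj₁ P₁))

  cuts≤ : ∑ (cutSize G) Xs₁ + 2 * eS ≤ 2 * E₁ + D
  cuts≤ = subst (λ n → ∑ (cutSize G) Xs₁ + 2 * eS ≤ 2 * n + D) (sym E₁≡) (∑cutSize≤ G S Xs₁ cover-outside)

Ω-bound-treeConnected : ∀ m k {N} (G : Graph N) → WF G → (S : VSet N) → S ⊆ V G →
  TreeConnected k G → m ≤ k →
  (ω₁ ω₂ : ℤ) → IsOmega m (G ∖ S) ω₁ → IsOmega m (G [ S ]) ω₂ →
  + k ℤ.* ω₁ ℤ.≤ sumOver S (λ v → + m ℤ.* (+ deg G v - + m) - + k ℤ.* + m)
                   ℤ.+ + k ℤ.* + m ℤ.+ + m ℤ.* ω₂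
Ω-bound-treeConnected m k {N} G wf S S⊆V tc m≤k _ _ (Xs₁ , P₁ , refl) (Xs₂ , P₂ , refl) = begin
  + k ℤ.* (+ (m * p₁) - + E₁)
    ≡⟨ *-diff k (m * p₁) E₁ ⟩
  + (k * (m * p₁)) - + (k * E₁)
    ≤⟨ diff-≤-diff _ _ (m * D + k * m + m * (m * p₂)) (s * (m * m + k * m) + m * E₂)
                   (tree-arith m k p₁ p₂ s E₁ E₂ eS D m≤k trees crossing≤ inner) ⟩
  + (m * D + k * m + m * (m * p₂)) - + (s * (m * m + k * m) + m * E₂)
    ≡⟨ diff-+-diff (m * D + k * m) (s * (m * m + k * m)) (m * (m * p₂)) (m * E₂) ⟨
  (+ (m * D + k * m) - + (s * (m * m + k * m))) ℤ.+ (+ (m * (m * p₂)) - + (m * E₂))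
    ≡⟨ cong₂ ℤ._+_ (diff-+ (m * D) (s * (m * m + k * m)) (k * m)) (*-diff m (m * p₂) E₂) ⟨
  (+ (m * D) - + (s * (m * m + k * m))) ℤ.+ + (k * m) ℤ.+ + m ℤ.* (+ (m * p₂) - + E₂)
    ≡⟨ cong₂ (λ x y → x ℤ.+ y ℤ.+ + m ℤ.* (+ (m * p₂) - + E₂))
             (sumOver-split (m * m + k * m) _ pointwise) (sym (ℤP.pos-* k m)) ⟨
  sumOver S (λ v → + m ℤ.* (+ deg G v - + m) - + k ℤ.* + m)
    ℤ.+ + k ℤ.* + m ℤ.+ + m ℤ.* (+ (m * p₂) - + E₂) ∎
  where
  open ℤP.≤-Reasoning
  open Split wf S S⊆V P₁ P₂

  trees : k * (p₁ + s) ≤ k + crossEdges G Qs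
  trees = subst (λ n → k * n ≤ k + crossEdges G Qs) length-Qs (treeConnected⇒crossEdges G tc Qs Qs-meet Qs-cover≤1)

  crossing≤ : crossEdges G Qs + eS ≤ E₁ + D
  crossing≤ = subst (λ n → crossEdges G Qs + eS ≤ n + D) (sym E₁≡) (crossEdges-++≤ G S Xs₁ (map ⦅_⦆ Svs))

  pointwise : ∀ v → + m ℤ.* (+ deg G v - + m) - + k ℤ.* + m ≡ + (m * deg G v) - + (m * m + k * m)
  pointwise v = trans (cong₂ _-_ (*-diff m (deg G v) m) (sym (ℤP.pos-* k m))) (diff-diff (m * deg G v) (m * m) (k * m))

lemma5p1 : (m k : ℕ) → 1 ≤ m → 1 ≤ k → (N : ℕ) → (G : Graph N) → WF G →
    (S : VSet N) → S ⊆ V G →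
    (EdgeConnected k G → 2 * m ≤ k → (Σ (Fin N) λ u → S u ≡ true) →
      (ω₁ ω₂ : ℤ) → IsOmega m (G ∖ S) ω₁ → IsOmega m (G [ S ]) ω₂ →
      (+ k) ℤ.* ω₁ ℤ.≤ sumOver S (λ v → (+ m) ℤ.* ((+ deg G v) - (+ (2 * m)))) ℤ.+ (+ (2 * m)) ℤ.* ω₂)
    ×
    (TreeConnected k G → m ≤ k →
      (ω₁ ω₂ : ℤ) → IsOmega m (G ∖ S) ω₁ → IsOmega m (G [ S ]) ω₂ →
      (+ k) ℤ.* ω₁ ℤ.≤ sumOver S (λ v → (+ m) ℤ.* ((+ deg G v) - (+ m)) - (+ k) ℤ.* (+ m))
                       ℤ.+ (+ k) ℤ.* (+ m) ℤ.+ (+ m) ℤ.* ω₂)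
lemma5p1 m k _ _ N G wf S S⊆V = Ω-bound-edgeConnected m k G wf S S⊆V , Ω-bound-treeConnected m k G wf S S⊆V
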